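{- Let $G$ be a topological group and $X$ a topological space, and let $W=G\times X$ with $G$ acting by $g(h,x)=(gh,x)$. Let $\{\pi_i:U_i\to W\}$ be a covering of $W$ in the local-section topology $T_G$. Then it has a refinement of the form $\{\mathrm{id}\times i_x:G\times V_x\to G\times X\}_{x\in X}$, where $V_x$ is an open neighbourhood of $x$ in $X$, $i_x$ is the inclusion, and $G$ acts on $G\times V_x$ by left multiplication on the first factor. That is, each $\mathrm{id}\times i_x$ factors through some $\pi_i$ by a $G$-map.
   Context: $T_G$ is the Grothendieck topology of $G$-spaces (topological spaces with continuous $G$-action) and continuous $G$-maps. A family $\{\pi_i:U_i\to W\}$ is a covering iff every point of $W$ has an open neighbourhood $V$ and a continuous map $s:V\to U_i$, for some $i$, with $\pi_is=\mathrm{id}_V$. -}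

module Defs where

open import Data.Product using (Σ; _×_; _,_; proj₁; proj₂)
open import Data.Unit using (⊤; tt)
open import Relation.Binary.PropositionalEquality using (_≡_)

Subset : Set → Set₁
Subset X = X → Set

_≐_ : {X : Set} → Subset X → Subset X → Set
U ≐ V = (∀ x → U x → V x) × (∀ x → V x → U x)

record Topology (X : Set) : Set₂ where
  field
    IsOpen   : Subset X → Set₁
    open-ext : ∀ {U V} → U ≐ V → IsOpen U → IsOpen V
    open-univ : IsOpen (λ _ → ⊤)
    open-∩   : ∀ {U V} → IsOpen U → IsOpen V → IsOpen (λ x → U x × V x)
    open-⋃   : {I : Set} (U : I → Subset X) → (∀ i → IsOpen (U i))
             → IsOpen (λ x → Σ I (λ i → U i x))

record Space : Set₂ where
  field
    Carrier  : Set
    topology : Topology Carrier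
  open Topology topology public

open Space public using (Carrier)

IsOpenIn : (X : Space) → Subset (Carrier X) → Set₁
IsOpenIn X = Space.IsOpen X

Continuous : (X Y : Space) → (Carrier X → Carrier Y) → Set₁
Continuous X Y f = ∀ U → IsOpenIn Y U → IsOpenIn X (λ x → U (f x))

prodTop : (X Y : Space) → Topology (Carrier X × Carrier Y)
prodTop X Y = record
  { IsOpen = IsOpenP
  ; open-ext = λ { (f , g) o p u → let (A , B , oA , oB , a , b , sub) = o p (g p u)
                                   in A , B , oA , oB , a , b , (λ x y ax by → f (x , y) (sub x y ax by)) }
  ; open-univ = λ p _ → (λ _ → ⊤) , (λ _ → ⊤) , Space.open-univ X , Space.open-univ Y , tt , tt , (λ _ _ _ _ → tt)
  ; open-∩ = λ oU oV p uv →
      let (A , B , oA , oB , a , b , sub) = oU p (proj₁ uv)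
          (A' , B' , oA' , oB' , a' , b' , sub') = oV p (proj₂ uv)
      in (λ x → A x × A' x) , (λ y → B y × B' y) , Space.open-∩ X oA oA' , Space.open-∩ Y oB oB'
         , (a , a') , (b , b') , (λ x y ax by → sub x y (proj₁ ax) (proj₁ by) , sub' x y (proj₂ ax) (proj₂ by))
  ; open-⋃ = λ U oU p iu →
      let (A , B , oA , oB , a , b , sub) = oU (proj₁ iu) p (proj₂ iu)
      in A , B , oA , oB , a , b , (λ x y ax by → proj₁ iu , sub x y ax by)
  }
  where
  IsOpenP : Subset (Carrier X × Carrier Y) → Set₁
  IsOpenP U = ∀ p → U p → Σ (Subset (Carrier X)) λ A → Σ (Subset (Carrier Y)) λ B →
                IsOpenIn X A × IsOpenIn Y B × A (proj₁ p) × B (proj₂ p) ×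
                (∀ x y → A x → B y → U (x , y))

_⊗_ : Space → Space → Space
X ⊗ Y = record { Carrier = Carrier X × Carrier Y ; topology = prodTop X Y }

subTop : (X : Space) (V : Subset (Carrier X)) → Topology (Σ (Carrier X) V)
subTop X V = record
  { IsOpen = λ W → Σ (Subset (Carrier X)) λ U → IsOpenIn X U × (W ≐ (λ y → U (proj₁ y)))
  ; open-ext = λ { (f , g) (U , oU , (h , k)) → U , oU , ((λ y w → h y (g y w)) , (λ y u → f y (k y u))) }
  ; open-univ = (λ _ → ⊤) , Space.open-univ X , ((λ _ _ → tt) , (λ _ _ → tt))
  ; open-∩ = λ { (U , oU , (h , k)) (U' , oU' , (h' , k')) →
      (λ x → U x × U' x) , Space.open-∩ X oU oU'
      , ((λ y w → h y (proj₁ w) , h' y (proj₂ w)) , (λ y u → k y (proj₁ u) , k' y (proj₂ u))) }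
  ; open-⋃ = λ W oW →
      (λ x → Σ _ λ i → proj₁ (oW i) x) , Space.open-⋃ X (λ i → proj₁ (oW i)) (λ i → proj₁ (proj₂ (oW i)))
      , ((λ y w → proj₁ w , proj₁ (proj₂ (proj₂ (oW (proj₁ w)))) y (proj₂ w))
        , (λ y u → proj₁ u , proj₂ (proj₂ (proj₂ (oW (proj₁ u)))) y (proj₂ u)))
  }

Sub : (X : Space) → Subset (Carrier X) → Space
Sub X V = record { Carrier = Σ (Carrier X) V ; topology = subTop X V }

cont-∘ : (X Y Z : Space) (f : Carrier X → Carrier Y) (g : Carrier Y → Carrier Z)
       → Continuous X Y f → Continuous Y Z g → Continuous X Z (λ x → g (f x))
cont-∘ X Y Z f g cf cg U oU = cf _ (cg U oU)

cont-proj₁ : (X Y : Space) → Continuous (X ⊗ Y) X proj₁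
cont-proj₁ X Y U oU p u = U , (λ _ → ⊤) , oU , Space.open-univ Y , u , tt , (λ x y ax _ → ax)

cont-proj₂ : (X Y : Space) → Continuous (X ⊗ Y) Y proj₂
cont-proj₂ X Y U oU p u = (λ _ → ⊤) , U , Space.open-univ X , oU , tt , u , (λ x y _ by → by)

cont-pair : (Z X Y : Space) (f : Carrier Z → Carrier X) (g : Carrier Z → Carrier Y)
          → Continuous Z X f → Continuous Z Y g → Continuous Z (X ⊗ Y) (λ z → f z , g z)
cont-pair Z X Y f g cf cg W oW =
  Space.open-ext Z eq (Space.open-⋃ Z Ui (λ i → Space.open-∩ Z (cf _ (oA i)) (cg _ (oB i))))
  where
  I = Σ (Carrier Z) λ z → W (f z , g z)
  box = λ (i : I) → oW (f (proj₁ i) , g (proj₁ i)) (proj₂ i)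
  A = λ (i : I) → proj₁ (box i)
  B = λ (i : I) → proj₁ (proj₂ (box i))
  oA = λ (i : I) → proj₁ (proj₂ (proj₂ (box i)))
  oB = λ (i : I) → proj₁ (proj₂ (proj₂ (proj₂ (box i))))
  Ui : I → Subset (Carrier Z)
  Ui i z = A i (f z) × B i (g z)
  eq : (λ z → Σ I λ i → Ui i z) ≐ (λ z → W (f z , g z))
  eq = (λ z u → let i = proj₁ u
                    (_ , _ , _ , _ , _ , _ , sub) = box i
                in sub (f z) (g z) (proj₁ (proj₂ u)) (proj₂ (proj₂ u)))
     , (λ z w → let (_ , _ , _ , _ , a , b , _) = box (z , w) in (z , w) , a , b)

record TopGroup : Set₂ where
  field
    space : Space
  G : Set
  G = Carrier space
  field
    _∙_ : G → G → G
    e   : G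
    _⁻¹ : G → G
    assoc    : ∀ a b c → (a ∙ b) ∙ c ≡ a ∙ (b ∙ c)
    identityˡ : ∀ a → e ∙ a ≡ a
    identityʳ : ∀ a → a ∙ e ≡ a
    inverseˡ : ∀ a → (a ⁻¹) ∙ a ≡ e
    inverseʳ : ∀ a → a ∙ (a ⁻¹) ≡ e
    mul-cont : Continuous (space ⊗ space) space (λ p → proj₁ p ∙ proj₂ p)
    inv-cont : Continuous space space _⁻¹

record GSpace (𝔾 : TopGroup) : Set₂ where
  open TopGroup 𝔾
  field
    space : Space
    act   : G → Carrier space → Carrier space
    act-e : ∀ x → act e x ≡ x
    act-∙ : ∀ g h x → act (g ∙ h) x ≡ act g (act h x)
    act-cont : Continuous (TopGroup.space 𝔾 ⊗ space) space (λ p → act (proj₁ p) (proj₂ p))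

open GSpace public using (act)

∣_∣ : {𝔾 : TopGroup} → GSpace 𝔾 → Set
∣ U ∣ = Carrier (GSpace.space U)

record GMap {𝔾 : TopGroup} (U W : GSpace 𝔾) : Set₁ where
  field
    map  : ∣ U ∣ → ∣ W ∣
    cont : Continuous (GSpace.space U) (GSpace.space W) map
    equivariant : ∀ g u → map (act U g u) ≡ act W g (map u)

open GMap public using (map)

trivialGSpace : (𝔾 : TopGroup) (Y : Space) → GSpace 𝔾
trivialGSpace 𝔾 Y = record
  { space = S ⊗ Y
  ; act = λ g p → (g ∙ proj₁ p) , proj₂ p
  ; act-e = λ p → cong (λ a → a , proj₂ p) (identityˡ (proj₁ p))
  ; act-∙ = λ g h p → cong (λ a → a , proj₂ p) (assoc g h (proj₁ p))
  ; act-cont =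
      cont-pair (S ⊗ (S ⊗ Y)) S Y
        (λ q → proj₁ q ∙ proj₁ (proj₂ q)) (λ q → proj₂ (proj₂ q))
        (cont-∘ (S ⊗ (S ⊗ Y)) (S ⊗ S) S (λ q → proj₁ q , proj₁ (proj₂ q)) (λ p → proj₁ p ∙ proj₂ p)
           (cont-pair (S ⊗ (S ⊗ Y)) S S proj₁ (λ q → proj₁ (proj₂ q))
              (cont-proj₁ S (S ⊗ Y))
              (cont-∘ (S ⊗ (S ⊗ Y)) (S ⊗ Y) S proj₂ proj₁ (cont-proj₂ S (S ⊗ Y)) (cont-proj₁ S Y)))
           mul-cont)
        (cont-∘ (S ⊗ (S ⊗ Y)) (S ⊗ Y) Y proj₂ proj₂ (cont-proj₂ S (S ⊗ Y)) (cont-proj₂ S Y))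
  }
  where
  open TopGroup 𝔾 renaming (space to S)
  open import Relation.Binary.PropositionalEquality using (cong)

-- Coverings in the local-section topology T_G: every point w of W has an
-- open neighbourhood V and a continuous section s : V → U_i of some π_i.
IsCovering : {𝔾 : TopGroup} {W : GSpace 𝔾} {I : Set} {U : I → GSpace 𝔾}
           → ((i : I) → GMap (U i) W) → Set₁
IsCovering {𝔾} {W} {I} {U} π =
  ∀ (w : ∣ W ∣) → Σ (Subset ∣ W ∣) λ V → IsOpenIn (GSpace.space W) V × V w ×
    Σ I λ i → Σ (Σ ∣ W ∣ V → ∣ U i ∣) λ s →
      Continuous (Sub (GSpace.space W) V) (GSpace.space (U i)) s ×
      (∀ v → map (π i) (s v) ≡ proj₁ v)

module Submission where

-- A local section s of some π_i near (e , x) is defined on an open set containing a slice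
-- {e} × B with x ∈ B.  Translating it by G gives the G-map (g , y) ↦ g · s (e , y) from
-- G × B to U_i, and equivariance of π_i shows that it lies over the inclusion G × B → G × X.

open import Defs
open import Data.Product using (Σ; _×_; _,_; proj₁; proj₂)
open import Data.Unit using (⊤; tt)
open import Relation.Binary.PropositionalEquality using (_≡_; cong; module ≡-Reasoning)

cont-const : (Z X : Space) (a : Carrier X) → Continuous Z X (λ _ → a)
cont-const Z X a U _ =
  Space.open-ext Z ((λ _ u → proj₁ u) , (λ _ u → u , tt))
    (Space.open-⋃ Z (λ (_ : U a) _ → ⊤) (λ _ → Space.open-univ Z))

cont-inclusion : (X : Space) (V : Subset (Carrier X)) → Continuous (Sub X V) X proj₁
cont-inclusion X V W oW = W , oW , ((λ _ w → w) , (λ _ w → w))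

cont-corestrict : (Z X : Space) (V : Subset (Carrier X)) (f : Carrier Z → Carrier X)
                  (f∈V : ∀ z → V (f z))
                → Continuous Z X f → Continuous Z (Sub X V) (λ z → f z , f∈V z)
cont-corestrict Z X V f f∈V cf W (O , oO , (W⊆O , O⊆W)) =
  Space.open-ext Z ((λ z o → O⊆W _ o) , (λ z w → W⊆O _ w)) (cf O oO)

open-contains-slice : (X Y : Space) {U : Subset (Carrier X × Carrier Y)}
                    → IsOpenIn (X ⊗ Y) U → ∀ {a b} → U (a , b)
                    → Σ (Subset (Carrier Y)) λ B → IsOpenIn Y B × B b × (∀ y → B y → U (a , y))
open-contains-slice X Y oU {a} {b} u =
  let (_ , B , _ , oB , a∈A , b∈B , box⊆U) = oU (a , b) u
  in B , oB , b∈B , (λ y y∈B → box⊆U a y a∈A y∈B)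

inducedGMap : (𝔾 : TopGroup) (Y : Space) (U : GSpace 𝔾) (σ : Carrier Y → ∣ U ∣)
            → Continuous Y (GSpace.space U) σ → GMap (trivialGSpace 𝔾 Y) U
inducedGMap 𝔾 Y U σ cσ = record
  { map = λ p → act U (proj₁ p) (σ (proj₂ p))
  ; cont = cont-∘ (S ⊗ Y) (S ⊗ GSpace.space U) (GSpace.space U)
             (λ p → proj₁ p , σ (proj₂ p)) (λ q → act U (proj₁ q) (proj₂ q))
             (cont-pair (S ⊗ Y) S (GSpace.space U) proj₁ (λ p → σ (proj₂ p))
                (cont-proj₁ S Y)
                (cont-∘ (S ⊗ Y) Y (GSpace.space U) proj₂ σ (cont-proj₂ S Y) cσ))
             (GSpace.act-cont U)
  ; equivariant = λ g p → GSpace.act-∙ U g (proj₁ p) (σ (proj₂ p))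
  }
  where open TopGroup 𝔾 renaming (space to S)

lemma1p6 : (𝔾 : TopGroup) (X : Space) (I : Set) (U : I → GSpace 𝔾)
    (π : (i : I) → GMap (U i) (trivialGSpace 𝔾 X))
    → IsCovering {𝔾} {trivialGSpace 𝔾 X} {I} {U} π
    → (x : Carrier X) → Σ (Subset (Carrier X)) λ Vₓ → IsOpenIn X Vₓ × Vₓ x ×
    Σ I λ i → Σ (GMap (trivialGSpace 𝔾 (Sub X Vₓ)) (U i)) λ f →
    ∀ (p : ∣ trivialGSpace 𝔾 (Sub X Vₓ) ∣) → map (π i) (map f p) ≡ (proj₁ p , proj₁ (proj₂ p))
lemma1p6 𝔾 X I U π cov x with cov (TopGroup.e 𝔾 , x)
... | V , oV , ex∈V , i , s , cs , s-section
  with open-contains-slice (TopGroup.space 𝔾) X oV ex∈V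
... | B , oB , x∈B , slice⊆V = B , oB , x∈B , i , inducedGMap 𝔾 (Sub X B) (U i) σ cσ , lies-over
  where
  open TopGroup 𝔾 renaming (space to S)
  open ≡-Reasoning

  ι : Carrier (Sub X B) → Σ (G × Carrier X) V
  ι y = (e , proj₁ y) , slice⊆V (proj₁ y) (proj₂ y)

  σ : Carrier (Sub X B) → ∣ U i ∣
  σ y = s (ι y)

  cσ : Continuous (Sub X B) (GSpace.space (U i)) σ
  cσ = cont-∘ (Sub X B) (Sub (S ⊗ X) V) (GSpace.space (U i)) ι s
         (cont-corestrict (Sub X B) (S ⊗ X) V (λ y → e , proj₁ y) (λ y → proj₂ (ι y))
            (cont-pair (Sub X B) S X (λ _ → e) proj₁ (cont-const (Sub X B) S e) (cont-inclusion X B)))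
         cs

  lies-over : ∀ p → map (π i) (act (U i) (proj₁ p) (σ (proj₂ p))) ≡ (proj₁ p , proj₁ (proj₂ p))
  lies-over (g , y) = begin
    map (π i) (act (U i) g (σ y))                ≡⟨ GMap.equivariant (π i) g (σ y) ⟩
    act (trivialGSpace 𝔾 X) g (map (π i) (σ y)) ≡⟨ cong (act (trivialGSpace 𝔾 X) g) (s-section (ι y)) ⟩
    (g ∙ e , proj₁ y)                            ≡⟨ cong (_, proj₁ y) (identityʳ g) ⟩
    (g , proj₁ y)                                ∎
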